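{- Let $G=(V,S,U)$ be a graph whose underlying graph $(V,S\cup U)$ is $2$-edge connected, and let $\mathcal{E}=(P_0,\ldots,P_q,P_{q+1},\ldots,P_t)$ be an ear decomposition of $G$ such that $P_{q+1},\ldots,P_t$ are exactly the trivial ears of $\mathcal{E}$. Then $T=E(P_0)\cup\cdots\cup E(P_q)$ is an unsafe spanning connected subgraph of $G$.
   Context: A graph $G=(V,S,U)$ is an undirected graph whose edge set $S\cup U$ is partitioned into safe edges $S$ and unsafe edges $U$. An edge set $T\subseteq S\cup U$ is an unsafe spanning connected subgraph of $G$ if $(V,T)$ is connected and, for every unsafe edge $e\in T\cap U$, $(V,T\setminus\{e\})$ is connected. An ear decomposition of a $2$-edge connected graph $G$ is a sequence $(P_0,P_1,\ldots,P_t)$ where $P_0$ is a cycle and each $P_i$, $i\ge1$, is a path or a cycle such that: the $P_i$ are pairwise edge-disjoint; letting $G_i$ be the graph with vertex set $\bigcup_{j\le i}V(P_j)$ and edge set $\bigcup_{j\le i}E(P_j)$, for $i\ge1$, if $P_i$ is a cycle then it has exactly one vertex in common with $V(G_{i-1})$, and if $P_i$ is a path then $V(P_i)\cap V(G_{i-1})$ consists exactly of the two endpoints of $P_i$; and $G_t=G$. Each $P_i$ is an ear; its size is its number of edges; an ear of size one is trivial, otherwise non-trivial. -}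

module Defs where

open import Data.Nat using (ℕ; zero; suc; _≤_; _<_)
open import Data.Fin using (Fin; zero; suc; toℕ; inject₁; fromℕ)
open import Data.Bool using (Bool; true; false)
open import Data.Product using (Σ; ∃; ∃-syntax; _×_; _,_)
open import Data.Sum using (_⊎_)
open import Data.Unit using (⊤)
open import Relation.Binary.PropositionalEquality using (_≡_; _≢_)

-- A (multi)graph G = (V, S, U): vertices Fin n, edges Fin m with endpoints
-- src/tgt (undirected: orientation is irrelevant), and a label
-- safe e ≡ true iff e ∈ S, safe e ≡ false iff e ∈ U.
record Graph (n m : ℕ) : Set where
  field
    src tgt : Fin m → Fin n
    safe    : Fin m → Bool
open Graph public

EdgeSet : ℕ → Set₁
EdgeSet m = Fin m → Set

module _ {n m : ℕ} (G : Graph n m) where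

  Joins : Fin m → Fin n → Fin n → Set
  Joins e u v = (src G e ≡ u × tgt G e ≡ v) ⊎ (src G e ≡ v × tgt G e ≡ u)

  data Walk (T : EdgeSet m) : Fin n → Fin n → Set where
    here : ∀ {u} → Walk T u u
    step : ∀ {u w v} (e : Fin m) → T e → Joins e u w → Walk T w v → Walk T u v

  Connected : EdgeSet m → Set
  Connected T = ∀ u v → Walk T u v

  _∖_ : EdgeSet m → Fin m → EdgeSet m
  (T ∖ e) x = T x × x ≢ e

  AllEdges : EdgeSet m
  AllEdges _ = ⊤

  TwoEdgeConnected : Set
  TwoEdgeConnected = Connected AllEdges × (∀ e → Connected (AllEdges ∖ e))

  UnsafeSCS : EdgeSet m → Set
  UnsafeSCS T = Connected T × (∀ e → T e → safe G e ≡ false → Connected (T ∖ e))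

  record Ear : Set where
    field
      size  : ℕ
      verts : Fin (suc size) → Fin n
      edges : Fin size → Fin m
      incid : ∀ i → Joins (edges i) (verts (inject₁ i)) (verts (suc i))
  open Ear public

  IsPath : Ear → Set
  IsPath P = 1 ≤ size P × (∀ i j → verts P i ≡ verts P j → i ≡ j)

  IsCycle : Ear → Set
  IsCycle P = 1 ≤ size P
            × verts P zero ≡ verts P (fromℕ (size P))
            × (∀ i j → verts P (inject₁ i) ≡ verts P (inject₁ j) → i ≡ j)

  OnEar : Ear → Fin n → Set
  OnEar P v = ∃[ a ] verts P a ≡ v

  EdgeOf : Ear → Fin m → Set
  EdgeOf P e = ∃[ a ] edges P a ≡ e

  record EarDecomposition : Set where
    field
      t    : ℕ
      ear  : Fin (suc t) → Ear
      first-cycle : IsCycle (ear zero)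
      -- ears are pairwise edge-disjoint (and no edge repeats within an ear)
      edge-disjoint : ∀ (i j : Fin (suc t)) (a : Fin (size (ear i))) (b : Fin (size (ear j)))
                      → edges (ear i) a ≡ edges (ear j) b
                      → Σ (i ≡ j) λ { _≡_.refl → a ≡ b }
      -- attachment conditions for P_i, i ≥ 1 (here P_(suc i), and
      -- V(G_(i)) = vertices of ears with index ≤ i)
      attach : ∀ (i : Fin t) →
        let P = ear (suc i)
            Common : Fin n → Set
            Common v = OnEar P v × ∃[ j ] (toℕ j ≤ toℕ i × OnEar (ear j) v)
        in (IsCycle P × ∃[ w ] (∀ v → (Common v → v ≡ w) × (v ≡ w → Common v)))
         ⊎ (IsPath P × (∀ v → (Common v → (v ≡ verts P zero ⊎ v ≡ verts P (fromℕ (size P))))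
                            × ((v ≡ verts P zero ⊎ v ≡ verts P (fromℕ (size P))) → Common v)))
      -- G_t = G
      covers-vertices : ∀ v → ∃[ j ] OnEar (ear j) v
      covers-edges    : ∀ e → ∃[ j ] EdgeOf (ear j) e
  open EarDecomposition public

{-# OPTIONS --safe #-}
-- A trivial ear adds no vertex, so every vertex of G lies on one of P₀, …, P_q.
-- Deleting one edge e of T removes at most one position of each ear, so along
-- every ear P_k with k ≤ q each vertex still walks, avoiding e, to an endpoint
-- of P_k (both endpoints are the attachment vertex if P_k is a cycle), which
-- lies on an earlier ear. By induction on k every vertex reaches the first
-- vertex of P₀. Thus T − e is connected for every edge e of T, safe or not.
module Submission where

open import Defs
open import Data.Nat using (ℕ; zero; suc; _≤_; _<_; z≤n; s≤s; _≤?_)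
open import Data.Nat.Properties using (<⇒≤; <-≤-trans; ≤-<-trans; <⇒≢; ≰⇒>)
import Data.Fin as Fin
open import Data.Fin using (Fin; toℕ; zero; suc; inject₁; fromℕ)
open import Data.Fin.Induction using (<-wellFounded)
open import Data.Bool using (false)
open import Data.Product using (_×_; _,_; ∃-syntax; proj₂)
open import Data.Sum using (_⊎_; inj₁; inj₂)
open import Function using (_∘_)
open import Induction.WellFounded using (Acc; acc)
open import Relation.Nullary using (yes; no)
open import Relation.Binary.PropositionalEquality using (_≡_; _≢_; refl; sym; trans; cong; subst)

module Walks {n m : ℕ} (G : Graph n m) where

  private variable X : EdgeSet m

  joins-sym : ∀ {e u v} → Joins G e u v → Joins G e v u
  joins-sym (inj₁ (p , q)) = inj₂ (p , q)
  joins-sym (inj₂ (p , q)) = inj₁ (p , q)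

  _++_ : ∀ {u v w} → Walk G X u v → Walk G X v w → Walk G X u w
  here         ++ q = q
  step e x j p ++ q = step e x j (p ++ q)

  reverse : ∀ {u v} → Walk G X u v → Walk G X v u
  reverse here           = here
  reverse (step e x j p) = reverse p ++ step e x (joins-sym j) here

  -- The tail (vs ∘ suc, es ∘ suc, inc ∘ suc) of a trail is again a trail,
  -- definitionally, which drives the recursions below.
  Trail : ∀ {k} → (Fin (suc k) → Fin n) → (Fin k → Fin m) → Set
  Trail vs es = ∀ i → Joins G (es i) (vs (inject₁ i)) (vs (suc i))

  trail-to-end : ∀ {k} (vs : Fin (suc k) → Fin n) (es : Fin k → Fin m) → Trail vs es
               → ∀ c → (∀ b → toℕ c ≤ toℕ b → X (es b)) → Walk G X (vs c) (vs (fromℕ k))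
  trail-to-end {k = zero}  vs es inc zero    _ = here
  trail-to-end {k = suc k} vs es inc zero    X∋ =
    step (es zero) (X∋ zero z≤n) (inc zero)
      (trail-to-end (vs ∘ suc) (es ∘ suc) (inc ∘ suc) zero (λ b _ → X∋ (suc b) z≤n))
  trail-to-end {k = suc k} vs es inc (suc c) X∋ =
    trail-to-end (vs ∘ suc) (es ∘ suc) (inc ∘ suc) c (λ b c≤b → X∋ (suc b) (s≤s c≤b))

  trail-to-start : ∀ {k} (vs : Fin (suc k) → Fin n) (es : Fin k → Fin m) → Trail vs es
                 → ∀ c → (∀ b → toℕ b < toℕ c → X (es b)) → Walk G X (vs c) (vs zero)
  trail-to-start             vs es inc zero    _ = here
  trail-to-start {k = suc k} vs es inc (suc c) X∋ =
    trail-to-start (vs ∘ suc) (es ∘ suc) (inc ∘ suc) c (λ b b<c → X∋ (suc b) (s≤s b<c))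
      ++ step (es zero) (X∋ zero (s≤s z≤n)) (joins-sym (inc zero)) here

  trail-to-start-or-end : ∀ {k} (vs : Fin (suc k) → Fin n) (es : Fin k → Fin m) → Trail vs es
                        → (A : ℕ) → (∀ b → toℕ b ≢ A → X (es b))
                        → ∀ c → Walk G X (vs c) (vs zero) ⊎ Walk G X (vs c) (vs (fromℕ k))
  trail-to-start-or-end vs es inc A X∋ c with toℕ c ≤? A
  ... | yes c≤A = inj₁ (trail-to-start vs es inc c (λ b b<c → X∋ b (<⇒≢ (<-≤-trans b<c c≤A))))
  ... | no  c≰A = inj₂ (trail-to-end vs es inc c (λ b c≤b → X∋ b (λ b≡A → <⇒≢ (<-≤-trans (≰⇒> c≰A) c≤b) (sym b≡A))))

module Ears {n m : ℕ} (G : Graph n m) where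
  open Walks G

  -- The excluded position A is a plain number, so that one hypothesis can
  -- serve all ears of a decomposition at once.
  AllEdgesBut : EdgeSet m → ℕ → Ear G → Set
  AllEdgesBut X A P = ∀ b → toℕ b ≢ A → X (edges P b)

  ear-to-start-or-end : ∀ {X} (P : Ear G) A → AllEdgesBut X A P → ∀ c
                      → Walk G X (verts P c) (verts P zero) ⊎ Walk G X (verts P c) (verts P (fromℕ (size P)))
  ear-to-start-or-end P = trail-to-start-or-end (verts P) (edges P) (incid P)

  cycle-to-start : ∀ {X} (P : Ear G) → IsCycle G P → ∀ A → AllEdgesBut X A P → ∀ c → Walk G X (verts P c) (verts P zero)
  cycle-to-start P (_ , closed , _) A X∋ c with ear-to-start-or-end P A X∋ c
  ... | inj₁ w = w
  ... | inj₂ w = subst (Walk G _ (verts P c)) (sym closed) w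

  trivial-ear-endpoint : ∀ (P : Ear G) → size P ≡ 1 → ∀ c → verts P c ≡ verts P zero ⊎ verts P c ≡ verts P (fromℕ (size P))
  trivial-ear-endpoint P refl zero       = inj₁ refl
  trivial-ear-endpoint P refl (suc zero) = inj₂ refl

module Decomposition {n m : ℕ} (G : Graph n m) (D : EarDecomposition G) where
  open Walks G
  open Ears G

  -- V(G_k): the vertices of the ears P₀, …, P_k.
  InFirstEars : ℕ → Fin n → Set
  InFirstEars k v = ∃[ j ] (toℕ j ≤ k × OnEar G (ear D j) v)

  root : Fin n
  root = verts (ear D zero) zero

  ear-reaches-attachment : ∀ {X} i A → AllEdgesBut X A (ear D (suc i))
                         → ∀ c → ∃[ v ] (Walk G X (verts (ear D (suc i)) c) v × InFirstEars (toℕ i) v)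
  ear-reaches-attachment i A X∋ c with attach D i
  ... | inj₁ (cyc , w , common) with proj₂ (common w) refl
  ...   | (d , d↦w) , w∈ =
          w , (toStart c ++ subst (Walk G _ _) d↦w (reverse (toStart d))) , w∈
    where
      toStart : ∀ x → Walk G _ (verts (ear D (suc i)) x) (verts (ear D (suc i)) zero)
      toStart = cycle-to-start (ear D (suc i)) cyc A X∋
  ear-reaches-attachment i A X∋ c | inj₂ (_ , common) with ear-to-start-or-end (ear D (suc i)) A X∋ c
  ... | inj₁ w = _ , w , proj₂ (proj₂ (common _) (inj₁ refl))
  ... | inj₂ w = _ , w , proj₂ (proj₂ (common _) (inj₂ refl))

  trivial-ear-attached : ∀ i → size (ear D (suc i)) ≡ 1 → ∀ c → InFirstEars (toℕ i) (verts (ear D (suc i)) c)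
  trivial-ear-attached i size≡1 c with attach D i
  ... | inj₂ (_ , common) = proj₂ (proj₂ (common _) (trivial-ear-endpoint (ear D (suc i)) size≡1 c))
  ... | inj₁ ((_ , closed , _) , w , common) with proj₂ (common w) refl
  ...   | (d , d↦w) , w∈ = subst (InFirstEars (toℕ i)) (sym c↦w) w∈
    where
      P : Ear G
      P = ear D (suc i)
      to-start : ∀ x → verts P x ≡ verts P zero
      to-start x with trivial-ear-endpoint P size≡1 x
      ... | inj₁ e = e
      ... | inj₂ e = trans e (sym closed)
      c↦w : verts P c ≡ w
      c↦w = trans (to-start c) (trans (sym (to-start d)) d↦w)

  edge-position-injective : ∀ {i j} {a : Fin (size (ear D i))} {b : Fin (size (ear D j))}
                          → edges (ear D i) a ≡ edges (ear D j) b → toℕ a ≡ toℕ b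
  edge-position-injective {i} {j} {a} {b} a↦b with edge-disjoint D i j a b a↦b
  ... | refl , a≡b = cong toℕ a≡b

  module _ (q : Fin (suc (t D))) (trivial-after-q : ∀ i → toℕ q < toℕ i → size (ear D i) ≡ 1) where

    vertex-on-first-ears : ∀ j → Acc Fin._<_ j → ∀ c → InFirstEars (toℕ q) (verts (ear D j) c)
    vertex-on-first-ears j _ c with toℕ j ≤? toℕ q
    ... | yes j≤q = j , j≤q , c , refl
    vertex-on-first-ears zero    _        c | no _ = zero , z≤n , c , refl
    vertex-on-first-ears (suc i) (acc rs) c | no j≰q
      with trivial-ear-attached i (trivial-after-q (suc i) (≰⇒> j≰q)) c
    ... | j , j≤i , d , d↦v with vertex-on-first-ears j (rs (s≤s j≤i)) d
    ...   | j' , j'≤q , d' , d'↦ = j' , j'≤q , d' , trans d'↦ d↦v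

    module _ {X : EdgeSet m} (A : ℕ) (X∋ : ∀ k → toℕ k ≤ toℕ q → AllEdgesBut X A (ear D k)) where

      ear-reaches-root : ∀ k → Acc Fin._<_ k → toℕ k ≤ toℕ q → ∀ c → Walk G X (verts (ear D k) c) root
      ear-reaches-root zero    _        0≤q c = cycle-to-start (ear D zero) (first-cycle D) A (X∋ zero 0≤q) c
      ear-reaches-root (suc i) (acc rs) i<q c with ear-reaches-attachment i A (X∋ (suc i) i<q) c
      ... | v , c↝v , j , j≤i , d , d↦v =
            c↝v ++ subst (λ x → Walk G X x root) d↦v (ear-reaches-root j (rs (s≤s j≤i)) (<⇒≤ (≤-<-trans j≤i i<q)) d)

      vertex-reaches-root : ∀ v → Walk G X v root
      vertex-reaches-root v with covers-vertices D v
      ... | j , c , c↦v with vertex-on-first-ears j (<-wellFounded j) c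
      ...   | j' , j'≤q , c' , c'↦ =
              subst (λ x → Walk G X x root) (trans c'↦ c↦v) (ear-reaches-root j' (<-wellFounded j') j'≤q c')

      first-ears-but-one-position-connected : Connected G X
      first-ears-but-one-position-connected u v = vertex-reaches-root u ++ reverse (vertex-reaches-root v)

lemma10 : ∀ {n m : ℕ} (G : Graph n m) → TwoEdgeConnected G
        → (D : EarDecomposition G) (q : Fin (suc (t D)))
        → (∀ i → toℕ q < toℕ i → size (ear D i) ≡ 1)
        → (∀ i → size (ear D i) ≡ 1 → toℕ q < toℕ i)
        → UnsafeSCS G (λ e → ∃[ i ] (toℕ i ≤ toℕ q × EdgeOf G (ear D i) e))
lemma10 {m = m} G _ D q trivial-after-q _ = connected 0 (λ k k≤q b _ → in-T k k≤q b) , removable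
  where
    open Decomposition G D
    open Ears G using (AllEdgesBut)

    T : EdgeSet m
    T e = ∃[ i ] (toℕ i ≤ toℕ q × EdgeOf G (ear D i) e)

    in-T : ∀ k → toℕ k ≤ toℕ q → ∀ b → T (edges (ear D k) b)
    in-T k k≤q b = k , k≤q , b , refl

    connected : ∀ {X} A → (∀ k → toℕ k ≤ toℕ q → AllEdgesBut X A (ear D k)) → Connected G X
    connected = first-ears-but-one-position-connected q trivial-after-q

    removable : ∀ e → T e → safe G e ≡ false → Connected G (_∖_ G T e)
    removable _ (i , i≤q , a , refl) _ =
      connected (toℕ a) (λ k k≤q b b≢a → in-T k k≤q b , b≢a ∘ edge-position-injective)
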